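{- Let $\mathcal{O}$ be an $\mathcal{SH}$ ontology in NNF, and let $\mathcal{O}'$ be the $\mathcal{EL}^\rightarrow$ ontology obtained from $\mathcal{O}$ by replacing $\forall$, $\sqcup$ and $\neg$ with $\bar\forall$, $\bar\sqcup$ and $\bar\neg$ respectively. If $\mathcal{O}$ is (set-theoretically) consistent, then $\mathcal{O}'$ is (categorically) $\mathcal{EL}^\rightarrow$-consistent.
   Context: $\mathcal{SH}$: concepts $\top,\bot,A,C\sqcap D,C\sqcup D,\neg C,\exists R.C,\forall R.C$; an ontology is a finite set of GCIs $C\sqsubseteq D$, role inclusions $R\sqsubseteq S$, transitivity axioms $S\circ S\sqsubseteq S$, concept assertions $\{a\}\sqsubseteq C$, role assertions $\{(a,b)\}\sqsubseteq R$, with standard Tarskian semantics; consistency means having a model. NNF: negation only in front of concept names. $\mathcal{EL}^{\rightarrow}$: same syntax with $\bar\sqcup,\bar\neg,\bar\forall$ in place of $\sqcup,\neg,\forall$, ontologies in NNF. Categorical saturation: one builds a concept structure and a role structure (sets of objects with a binary arrow relation $\rightarrow$). Concept objects are formal expressions (concepts, individual objects $\{a\}$, and $\Pi_\ell(R),\Pi_r(R)$ for role objects $R$), identified up to associativity, commutativity and idempotence of $\sqcap$ and $\bar\sqcup$; role objects are role names, $\{(a,b)\}$, $\mathfrak R_\top,\mathfrak R_\bot$, $S\circ S$, and a fresh $\mathfrak R_{(\exists R.C)}$ for each object $\exists R.C$. Initially: $\top,\bot$, concept names, $\{a\}$ for individuals, $\mathfrak R_\top,\mathfrak R_\bot$,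 role names; adding an arrow adds its endpoints. $X\leftrightarrows Y$ means $X\rightarrow Y$ and $Y\rightarrow X$. Rules applied until none adds anything: (it) concept object $X$: $X\rightarrow\top,\bot\rightarrow X,X\rightarrow X$; role object $X$: $X\rightarrow\mathfrak R_\top,\mathfrak R_\bot\rightarrow X,X\rightarrow X$; (r) role object $R$ $\Rightarrow$ objects $\Pi_\ell(R),\Pi_r(R)$; (tr) $X\rightarrow Y\rightarrow Z$ $\Rightarrow$ $X\rightarrow Z$; (f) $\Pi_\ell(R)\rightarrow\bot$ $\Rightarrow$ $\Pi_r(R)\rightarrow\bot$ and conversely; (ax) each axiom $X\sqsubseteq Y\in\mathcal O$ gives $X\rightarrow Y$ (concept arrow for GCIs and concept assertions, role arrow for role axioms); ($\sqcap$d) object $C\sqcap D$ $\Rightarrow$ $C\sqcap D\rightarrow C$, $C\sqcap D\rightarrow D$; ($\sqcap$c) $X\rightarrow C$, $X\rightarrow D$, object $C\sqcap D$ $\Rightarrow$ $X\rightarrow C\sqcap D$; ($\sqcup$d) $C\bar\sqcup D\rightarrow X$ $\Rightarrow$ $C\rightarrow X$, $D\rightarrow X$; ($\sqcup$c) $C\rightarrow X$, $D\rightarrow X$, object $C\bar\sqcup D$ $\Rightarrow$ $C\bar\sqcup D\rightarrow X$; ($\neg$) $X\rightarrow A$, $X\rightarrow\bar\neg A$ $\Rightarrow$ $X\rightarrow\bot$; ($\exists$) object $\exists R.C$ $\Rightarrow$ object $C$, $\mathfrak R_{(\exists R.C)}\rightarrow R$, $\exists R.C\leftrightarrows\Pi_\ell(\mathfrak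 R_{(\exists R.C)})$, $\Pi_r(\mathfrak R_{(\exists R.C)})\rightarrow C$; ($\exists$H) object $\exists R.C$, $R'\rightarrow R$, $\Pi_r(R')\rightarrow C$ $\Rightarrow$ $\Pi_\ell(R')\rightarrow\Pi_\ell(\mathfrak R_{(\exists R.C)})$; ($\exists\circ$) $S\circ S\rightarrow S$, $X\rightarrow\exists S.C$, $C\rightarrow\exists S.D$ $\Rightarrow$ $X\rightarrow\exists S.D$; ($\exists\bar\forall$) $X\rightarrow\exists P.C$, $X\rightarrow\bar\forall R.D$, $P\rightarrow R$ $\Rightarrow$ object $C\sqcap D$; ($\exists\forall$) $X\rightarrow\exists P.C$, $X\rightarrow\bar\forall R.D$, $P\rightarrow R$, $C\sqcap D\rightarrow\bot$ $\Rightarrow$ $X\rightarrow\bot$; ($\exists\forall$I) $\{(a,b)\}\rightarrow P$, $\{a\}\rightarrow\bar\forall R.D$, $P\rightarrow R$ $\Rightarrow$ $\{a\}\rightarrow\exists P.D$, $\{b\}\rightarrow D$; ($\exists\circ\bar\forall$) $P\rightarrow S$, $S\circ S\rightarrow S$, $S\rightarrow R$, $X\rightarrow\exists P.C$, $X\rightarrow\bar\forall R.D$ $\Rightarrow$ object $C\sqcap\bar\forall S.D$; ($\exists\circ\forall$) the same premises plus $C\sqcap\bar\forall S.D\rightarrow\bot$ $\Rightarrow$ $X\rightarrow\bot$; ($\exists\circ\forall$I) $P\rightarrow S$, $S\circ S\rightarrow S$, $S\rightarrow R$, $\{(a,b)\}\rightarrow P$, $\{a\}\rightarrow\bar\forall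 R.D$ $\Rightarrow$ $\{a\}\rightarrow\exists P.\bar\forall S.D$, $\{b\}\rightarrow\bar\forall S.D$. $\mathcal O'$ is $\mathcal{EL}^\rightarrow$-inconsistent iff the saturated concept structure contains $\{a\}\rightarrow\bot$ for some individual $a$, and $\mathcal{EL}^\rightarrow$-consistent otherwise. -}

module Defs where

open import Data.Nat using (ℕ)
open import Data.List using (List; map)
open import Data.List.Membership.Propositional using (_∈_)
open import Data.List.Relation.Unary.All using (All)
open import Data.Product using (Σ; _×_)
open import Data.Sum using (_⊎_)
open import Data.Unit using (⊤)
open import Data.Empty using (⊥)
open import Relation.Nullary using (¬_)
open import Level using (Level; suc; zero)

CName RName IName : Set
CName = ℕ
RName = ℕ
IName = ℕ

data Concept : Set where
  ⊤ᶜ ⊥ᶜ : Concept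
  atom  : CName → Concept
  _⊓_ _⊔_ : Concept → Concept → Concept
  ¬ᶜ    : Concept → Concept
  ∃ᶜ ∀ᶜ : RName → Concept → Concept

data Axiom : Set where
  gci     : Concept → Concept → Axiom
  rinc    : RName → RName → Axiom
  transAx : RName → Axiom                    -- S ∘ S ⊑ S
  cassert : IName → Concept → Axiom          -- {a} ⊑ C
  rassert : IName → IName → RName → Axiom    -- {(a,b)} ⊑ R

Ontology : Set
Ontology = List Axiom

data NNF : Concept → Set where
  nnf-⊤ : NNF ⊤ᶜ
  nnf-⊥ : NNF ⊥ᶜ
  nnf-atom : ∀ A → NNF (atom A)
  nnf-¬atom : ∀ A → NNF (¬ᶜ (atom A))
  nnf-⊓ : ∀ {C D} → NNF C → NNF D → NNF (C ⊓ D)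
  nnf-⊔ : ∀ {C D} → NNF C → NNF D → NNF (C ⊔ D)
  nnf-∃ : ∀ {R C} → NNF C → NNF (∃ᶜ R C)
  nnf-∀ : ∀ {R C} → NNF C → NNF (∀ᶜ R C)

data AxNNF : Axiom → Set where
  gci-nnf : ∀ {C D} → NNF C → NNF D → AxNNF (gci C D)
  rinc-nnf : ∀ {R S} → AxNNF (rinc R S)
  trans-nnf : ∀ {S} → AxNNF (transAx S)
  cassert-nnf : ∀ {a C} → NNF C → AxNNF (cassert a C)
  rassert-nnf : ∀ {a b R} → AxNNF (rassert a b R)

OntologyNNF : Ontology → Set
OntologyNNF O = All AxNNF O

record Interpretation : Set₁ where
  field
    Δ    : Set
    conI : CName → Δ → Set
    roleI : RName → Δ → Δ → Set
    indI : IName → Δ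

module _ (I : Interpretation) where
  open Interpretation I

  ⟦_⟧ : Concept → Δ → Set
  ⟦ ⊤ᶜ ⟧ x = ⊤
  ⟦ ⊥ᶜ ⟧ x = ⊥
  ⟦ atom A ⟧ x = conI A x
  ⟦ C ⊓ D ⟧ x = ⟦ C ⟧ x × ⟦ D ⟧ x
  ⟦ C ⊔ D ⟧ x = ⟦ C ⟧ x ⊎ ⟦ D ⟧ x
  ⟦ ¬ᶜ C ⟧ x = ¬ ⟦ C ⟧ x
  ⟦ ∃ᶜ R C ⟧ x = Σ Δ λ y → roleI R x y × ⟦ C ⟧ y
  ⟦ ∀ᶜ R C ⟧ x = ∀ y → roleI R x y → ⟦ C ⟧ y

  SatAx : Axiom → Set
  SatAx (gci C D) = ∀ x → ⟦ C ⟧ x → ⟦ D ⟧ x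
  SatAx (rinc R S) = ∀ x y → roleI R x y → roleI S x y
  SatAx (transAx S) = ∀ x y z → roleI S x y → roleI S y z → roleI S x z
  SatAx (cassert a C) = ⟦ C ⟧ (indI a)
  SatAx (rassert a b R) = roleI R (indI a) (indI b)

_⊨_ : Interpretation → Ontology → Set
I ⊨ O = All (SatAx I) O

Consistent : Ontology → Set₁
Consistent O = Σ Interpretation λ I → I ⊨ O

data EConcept : Set where
  ⊤ᵉ ⊥ᵉ : EConcept
  eatom : CName → EConcept
  _⊓ᵉ_ _⊔̄_ : EConcept → EConcept → EConcept
  ¬̄ : EConcept → EConcept
  ∃ᵉ ∀̄ : RName → EConcept → EConcept

data EAxiom : Set where
  egci     : EConcept → EConcept → EAxiom
  erinc    : RName → RName → EAxiom
  etransAx : RName → EAxiom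
  ecassert : IName → EConcept → EAxiom
  erassert : IName → IName → RName → EAxiom

EOntology : Set
EOntology = List EAxiom

trC : Concept → EConcept
trC ⊤ᶜ = ⊤ᵉ
trC ⊥ᶜ = ⊥ᵉ
trC (atom A) = eatom A
trC (C ⊓ D) = trC C ⊓ᵉ trC D
trC (C ⊔ D) = trC C ⊔̄ trC D
trC (¬ᶜ C) = ¬̄ (trC C)
trC (∃ᶜ R C) = ∃ᵉ R (trC C)
trC (∀ᶜ R C) = ∀̄ R (trC C)

trAx : Axiom → EAxiom
trAx (gci C D) = egci (trC C) (trC D)
trAx (rinc R S) = erinc R S
trAx (transAx S) = etransAx S
trAx (cassert a C) = ecassert a (trC C)
trAx (rassert a b R) = erassert a b R

trO : Ontology → EOntology
trO = map trAx

infix 4 _≈_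
data _≈_ : EConcept → EConcept → Set where
  ≈-refl  : ∀ {C} → C ≈ C
  ≈-sym   : ∀ {C D} → C ≈ D → D ≈ C
  ≈-trans : ∀ {C D E} → C ≈ D → D ≈ E → C ≈ E
  ⊓-assoc : ∀ {C D E} → (C ⊓ᵉ D) ⊓ᵉ E ≈ C ⊓ᵉ (D ⊓ᵉ E)
  ⊓-comm  : ∀ {C D} → C ⊓ᵉ D ≈ D ⊓ᵉ C
  ⊓-idem  : ∀ {C} → C ⊓ᵉ C ≈ C
  ⊔-assoc : ∀ {C D E} → (C ⊔̄ D) ⊔̄ E ≈ C ⊔̄ (D ⊔̄ E)
  ⊔-comm  : ∀ {C D} → C ⊔̄ D ≈ D ⊔̄ C
  ⊔-idem  : ∀ {C} → C ⊔̄ C ≈ C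
  ⊓-cong  : ∀ {C C' D D'} → C ≈ C' → D ≈ D' → C ⊓ᵉ D ≈ C' ⊓ᵉ D'
  ⊔-cong  : ∀ {C C' D D'} → C ≈ C' → D ≈ D' → C ⊔̄ D ≈ C' ⊔̄ D'
  ¬-cong  : ∀ {C C'} → C ≈ C' → ¬̄ C ≈ ¬̄ C'
  ∃-cong  : ∀ {R C C'} → C ≈ C' → ∃ᵉ R C ≈ ∃ᵉ R C'
  ∀-cong  : ∀ {R C C'} → C ≈ C' → ∀̄ R C ≈ ∀̄ R C'

data RObj : Set
data CObj : Set

data CObj where
  con : EConcept → CObj
  ind : IName → CObj
  Πℓ Πr : RObj → CObj

data RObj where
  rn   : RName → RObj
  pr   : IName → IName → RObj
  𝔑⊤ 𝔑⊥ : RObj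
  comp : RName → RObj            -- S ∘ S
  𝔑∃  : RName → EConcept → RObj

data _≈ᶜ_ : CObj → CObj → Set
data _≈ʳ_ : RObj → RObj → Set

data _≈ᶜ_ where
  con-≈ : ∀ {C D} → C ≈ D → con C ≈ᶜ con D
  ind-≈ : ∀ {a} → ind a ≈ᶜ ind a
  Πℓ-≈  : ∀ {R R'} → R ≈ʳ R' → Πℓ R ≈ᶜ Πℓ R'
  Πr-≈  : ∀ {R R'} → R ≈ʳ R' → Πr R ≈ᶜ Πr R'

data _≈ʳ_ where
  rn-≈   : ∀ {R} → rn R ≈ʳ rn R
  pr-≈   : ∀ {a b} → pr a b ≈ʳ pr a b
  𝔑⊤-≈   : 𝔑⊤ ≈ʳ 𝔑⊤
  𝔑⊥-≈   : 𝔑⊥ ≈ʳ 𝔑⊥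
  comp-≈ : ∀ {S} → comp S ≈ʳ comp S
  𝔑∃-≈   : ∀ {R C C'} → C ≈ C' → 𝔑∃ R C ≈ʳ 𝔑∃ R C'

-- Categorical saturation: the least concept/role structures closed
-- under all rules (objects and arrows, modulo ACI identification).

module Saturation (O : EOntology) where

  data CIs : CObj → Set
  data RIs : RObj → Set
  data _⇒_ : CObj → CObj → Set
  data _⇛_ : RObj → RObj → Set

  infix 4 _⇒_ _⇛_

  data CIs where
    init-⊤ : CIs (con ⊤ᵉ)
    init-⊥ : CIs (con ⊥ᵉ)
    init-A : ∀ A → CIs (con (eatom A))
    init-a : ∀ a → CIs (ind a)
    src : ∀ {X Y} → X ⇒ Y → CIs X
    tgt : ∀ {X Y} → X ⇒ Y → CIs Y
    resp : ∀ {X Y} → CIs X → X ≈ᶜ Y → CIs Y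
    r-ℓ : ∀ {R} → RIs R → CIs (Πℓ R)
    r-r : ∀ {R} → RIs R → CIs (Πr R)
    ∃-obj : ∀ {R C} → CIs (con (∃ᵉ R C)) → CIs (con C)
    ∃∀̄ : ∀ {X P C R D} → X ⇒ con (∃ᵉ P C) → X ⇒ con (∀̄ R D) → rn P ⇛ rn R
        → CIs (con (C ⊓ᵉ D))
    ∃∘∀̄ : ∀ {X P S R C D} → rn P ⇛ rn S → comp S ⇛ rn S → rn S ⇛ rn R
        → X ⇒ con (∃ᵉ P C) → X ⇒ con (∀̄ R D)
        → CIs (con (C ⊓ᵉ ∀̄ S D))

  data RIs where
    init-𝔑⊤ : RIs 𝔑⊤
    init-𝔑⊥ : RIs 𝔑⊥
    init-R  : ∀ R → RIs (rn R)
    src : ∀ {X Y} → X ⇛ Y → RIs X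
    tgt : ∀ {X Y} → X ⇛ Y → RIs Y
    resp : ∀ {X Y} → RIs X → X ≈ʳ Y → RIs Y

  data _⇒_ where
    resp : ∀ {X X' Y Y'} → X ⇒ Y → X ≈ᶜ X' → Y ≈ᶜ Y' → X' ⇒ Y'
    it-⊤ : ∀ {X} → CIs X → X ⇒ con ⊤ᵉ
    it-⊥ : ∀ {X} → CIs X → con ⊥ᵉ ⇒ X
    it-id : ∀ {X} → CIs X → X ⇒ X
    tr : ∀ {X Y Z} → X ⇒ Y → Y ⇒ Z → X ⇒ Z
    f-ℓr : ∀ {R} → Πℓ R ⇒ con ⊥ᵉ → Πr R ⇒ con ⊥ᵉ
    f-rℓ : ∀ {R} → Πr R ⇒ con ⊥ᵉ → Πℓ R ⇒ con ⊥ᵉ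
    ax-gci : ∀ {C D} → egci C D ∈ O → con C ⇒ con D
    ax-ca  : ∀ {a C} → ecassert a C ∈ O → ind a ⇒ con C
    ⊓d₁ : ∀ {C D} → CIs (con (C ⊓ᵉ D)) → con (C ⊓ᵉ D) ⇒ con C
    ⊓d₂ : ∀ {C D} → CIs (con (C ⊓ᵉ D)) → con (C ⊓ᵉ D) ⇒ con D
    ⊓c : ∀ {X C D} → X ⇒ con C → X ⇒ con D → CIs (con (C ⊓ᵉ D))
        → X ⇒ con (C ⊓ᵉ D)
    ⊔d₁ : ∀ {C D X} → con (C ⊔̄ D) ⇒ X → con C ⇒ X
    ⊔d₂ : ∀ {C D X} → con (C ⊔̄ D) ⇒ X → con D ⇒ X
    ⊔c : ∀ {C D X} → con C ⇒ X → con D ⇒ X → CIs (con (C ⊔̄ D))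
        → con (C ⊔̄ D) ⇒ X
    neg : ∀ {X A} → X ⇒ con (eatom A) → X ⇒ con (¬̄ (eatom A)) → X ⇒ con ⊥ᵉ
    ∃-ℓ₁ : ∀ {R C} → CIs (con (∃ᵉ R C)) → con (∃ᵉ R C) ⇒ Πℓ (𝔑∃ R C)
    ∃-ℓ₂ : ∀ {R C} → CIs (con (∃ᵉ R C)) → Πℓ (𝔑∃ R C) ⇒ con (∃ᵉ R C)
    ∃-r  : ∀ {R C} → CIs (con (∃ᵉ R C)) → Πr (𝔑∃ R C) ⇒ con C
    ∃H : ∀ {R C R'} → CIs (con (∃ᵉ R C)) → R' ⇛ rn R → Πr R' ⇒ con C
        → Πℓ R' ⇒ Πℓ (𝔑∃ R C)
    ∃∘ : ∀ {S X C D} → comp S ⇛ rn S → X ⇒ con (∃ᵉ S C) → con C ⇒ con (∃ᵉ S D)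
        → X ⇒ con (∃ᵉ S D)
    ∃∀ : ∀ {X P C R D} → X ⇒ con (∃ᵉ P C) → X ⇒ con (∀̄ R D) → rn P ⇛ rn R
        → con (C ⊓ᵉ D) ⇒ con ⊥ᵉ → X ⇒ con ⊥ᵉ
    ∃∀I₁ : ∀ {a b P R D} → pr a b ⇛ rn P → ind a ⇒ con (∀̄ R D) → rn P ⇛ rn R
        → ind a ⇒ con (∃ᵉ P D)
    ∃∀I₂ : ∀ {a b P R D} → pr a b ⇛ rn P → ind a ⇒ con (∀̄ R D) → rn P ⇛ rn R
        → ind b ⇒ con D
    ∃∘∀ : ∀ {X P S R C D} → rn P ⇛ rn S → comp S ⇛ rn S → rn S ⇛ rn R
        → X ⇒ con (∃ᵉ P C) → X ⇒ con (∀̄ R D)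
        → con (C ⊓ᵉ ∀̄ S D) ⇒ con ⊥ᵉ → X ⇒ con ⊥ᵉ
    ∃∘∀I₁ : ∀ {a b P S R D} → rn P ⇛ rn S → comp S ⇛ rn S → rn S ⇛ rn R
        → pr a b ⇛ rn P → ind a ⇒ con (∀̄ R D)
        → ind a ⇒ con (∃ᵉ P (∀̄ S D))
    ∃∘∀I₂ : ∀ {a b P S R D} → rn P ⇛ rn S → comp S ⇛ rn S → rn S ⇛ rn R
        → pr a b ⇛ rn P → ind a ⇒ con (∀̄ R D)
        → ind b ⇒ con (∀̄ S D)

  data _⇛_ where
    resp : ∀ {X X' Y Y'} → X ⇛ Y → X ≈ʳ X' → Y ≈ʳ Y' → X' ⇛ Y'
    it-⊤ : ∀ {X} → RIs X → X ⇛ 𝔑⊤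
    it-⊥ : ∀ {X} → RIs X → 𝔑⊥ ⇛ X
    it-id : ∀ {X} → RIs X → X ⇛ X
    tr : ∀ {X Y Z} → X ⇛ Y → Y ⇛ Z → X ⇛ Z
    ax-rinc  : ∀ {R S} → erinc R S ∈ O → rn R ⇛ rn S
    ax-trans : ∀ {S} → etransAx S ∈ O → comp S ⇛ rn S
    ax-ra    : ∀ {a b R} → erassert a b R ∈ O → pr a b ⇛ rn R
    ∃-role : ∀ {R C} → CIs (con (∃ᵉ R C)) → 𝔑∃ R C ⇛ rn R

ELInconsistent : EOntology → Set
ELInconsistent O = Σ IName λ a → ind a ⇒ con ⊥ᵉ
  where open Saturation O

ELConsistent : EOntology → Set
ELConsistent O = ¬ ELInconsistent O

-- Read EL→ set-theoretically in an SH interpretation: ⊔̄, ¬̄, ∀̄ as ⊔, ¬, ∀,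
-- Π_ℓ(R) and Π_r(R) as the domain and range of R, {(a,b)} as a single edge,
-- S ∘ S as relational composition and 𝔑_(∃R.C) as the R-edges ending in C.
-- Under this reading every saturation rule is sound: each derived arrow
-- X → Y is an inclusion X^I ⊆ Y^I. Since reading trO O back as SH gives O,
-- a model of O would put a^I into ⊥^I = ∅ if {a} → ⊥ were derived.
module Submission where

open import Defs
open import Data.List using (map)
open import Data.List.Properties using (map-∘; map-cong; map-id)
open import Data.List.Membership.Propositional using (_∈_)
open import Data.List.Membership.Propositional.Properties using (∈-map⁺)
open import Data.List.Relation.Unary.All using (lookup)
open import Data.Product using (Σ; _×_; _,_; proj₁)
open import Data.Product.Function.NonDependent.Propositional using (_×-⇔_)
import Data.Product.Function.Dependent.Propositional as Σ
open import Data.Sum using (inj₁; inj₂; swap; reduce; assocʳ; assocˡ)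
open import Data.Sum.Function.Propositional using (_⊎-⇔_)
open import Data.Unit using (tt) renaming (⊤ to Unit)
open import Data.Empty using (⊥)
open import Function using (_∘_)
open import Function.Bundles using (_⇔_; mk⇔; Equivalence)
import Function.Properties.Equivalence as ⇔
open import Function.Related.TypeIsomorphisms using (¬-cong-⇔; →-cong-⇔)
open import Relation.Binary.PropositionalEquality using (_≡_; refl; cong; cong₂; subst; sym; module ≡-Reasoning)
open import Relation.Unary using (_⊆_)

open Equivalence using (to; from)

toSHᶜ : EConcept → Concept
toSHᶜ ⊤ᵉ = ⊤ᶜ
toSHᶜ ⊥ᵉ = ⊥ᶜ
toSHᶜ (eatom A) = atom A
toSHᶜ (C ⊓ᵉ D) = toSHᶜ C ⊓ toSHᶜ D
toSHᶜ (C ⊔̄ D) = toSHᶜ C ⊔ toSHᶜ D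
toSHᶜ (¬̄ C) = ¬ᶜ (toSHᶜ C)
toSHᶜ (∃ᵉ R C) = ∃ᶜ R (toSHᶜ C)
toSHᶜ (∀̄ R C) = ∀ᶜ R (toSHᶜ C)

toSHᵃ : EAxiom → Axiom
toSHᵃ (egci C D) = gci (toSHᶜ C) (toSHᶜ D)
toSHᵃ (erinc R S) = rinc R S
toSHᵃ (etransAx S) = transAx S
toSHᵃ (ecassert a C) = cassert a (toSHᶜ C)
toSHᵃ (erassert a b R) = rassert a b R

toSH : EOntology → Ontology
toSH = map toSHᵃ

toSHᶜ-trC : ∀ C → toSHᶜ (trC C) ≡ C
toSHᶜ-trC ⊤ᶜ = refl
toSHᶜ-trC ⊥ᶜ = refl
toSHᶜ-trC (atom A) = refl
toSHᶜ-trC (C ⊓ D) = cong₂ _⊓_ (toSHᶜ-trC C) (toSHᶜ-trC D)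
toSHᶜ-trC (C ⊔ D) = cong₂ _⊔_ (toSHᶜ-trC C) (toSHᶜ-trC D)
toSHᶜ-trC (¬ᶜ C) = cong ¬ᶜ (toSHᶜ-trC C)
toSHᶜ-trC (∃ᶜ R C) = cong (∃ᶜ R) (toSHᶜ-trC C)
toSHᶜ-trC (∀ᶜ R C) = cong (∀ᶜ R) (toSHᶜ-trC C)

toSHᵃ-trAx : ∀ ax → toSHᵃ (trAx ax) ≡ ax
toSHᵃ-trAx (gci C D) = cong₂ gci (toSHᶜ-trC C) (toSHᶜ-trC D)
toSHᵃ-trAx (rinc R S) = refl
toSHᵃ-trAx (transAx S) = refl
toSHᵃ-trAx (cassert a C) = cong (cassert a) (toSHᶜ-trC C)
toSHᵃ-trAx (rassert a b R) = refl

toSH-trO : ∀ O → toSH (trO O) ≡ O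
toSH-trO O = begin
  map toSHᵃ (map trAx O)  ≡⟨ map-∘ O ⟨
  map (toSHᵃ ∘ trAx) O    ≡⟨ map-cong toSHᵃ-trAx O ⟩
  map (λ ax → ax) O       ≡⟨ map-id O ⟩
  O                       ∎
  where open ≡-Reasoning

∀-cong-⇔ : ∀ {A : Set} {P Q : A → Set} → (∀ x → P x ⇔ Q x) → (∀ x → P x) ⇔ (∀ x → Q x)
∀-cong-⇔ P⇔Q = mk⇔ (λ p x → to (P⇔Q x) (p x)) (λ q x → from (P⇔Q x) (q x))

module Semantics (I : Interpretation) where
  open Interpretation I

  ⟦_⟧ᵉ : EConcept → Δ → Set
  ⟦ C ⟧ᵉ = ⟦ I ⟧ (toSHᶜ C)

  ≈-sound : ∀ {C D} → C ≈ D → ∀ x → ⟦ C ⟧ᵉ x ⇔ ⟦ D ⟧ᵉ x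
  ≈-sound ≈-refl x = ⇔.refl
  ≈-sound (≈-sym e) x = ⇔.sym (≈-sound e x)
  ≈-sound (≈-trans e f) x = ⇔.trans (≈-sound e x) (≈-sound f x)
  ≈-sound ⊓-assoc x = mk⇔ (λ ((p , q) , r) → p , (q , r)) (λ (p , (q , r)) → (p , q) , r)
  ≈-sound ⊓-comm x = mk⇔ (λ (p , q) → q , p) (λ (p , q) → q , p)
  ≈-sound ⊓-idem x = mk⇔ proj₁ (λ p → p , p)
  ≈-sound ⊔-assoc x = mk⇔ assocʳ assocˡ
  ≈-sound ⊔-comm x = mk⇔ swap swap
  ≈-sound ⊔-idem x = mk⇔ reduce inj₁
  ≈-sound (⊓-cong e f) x = ≈-sound e x ×-⇔ ≈-sound f x
  ≈-sound (⊔-cong e f) x = ≈-sound e x ⊎-⇔ ≈-sound f x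
  ≈-sound (¬-cong e) x = ¬-cong-⇔ (≈-sound e x)
  ≈-sound (∃-cong e) x = Σ.congˡ (⇔.refl ×-⇔ ≈-sound e _)
  ≈-sound (∀-cong e) x = ∀-cong-⇔ λ y → →-cong-⇔ ⇔.refl (≈-sound e y)

  ⟦_⟧ʳ : RObj → Δ → Δ → Set
  ⟦ rn R ⟧ʳ = roleI R
  ⟦ pr a b ⟧ʳ x y = x ≡ indI a × y ≡ indI b
  ⟦ 𝔑⊤ ⟧ʳ x y = Unit
  ⟦ 𝔑⊥ ⟧ʳ x y = ⊥
  ⟦ comp S ⟧ʳ x z = Σ Δ λ y → roleI S x y × roleI S y z
  ⟦ 𝔑∃ R C ⟧ʳ x y = roleI R x y × ⟦ C ⟧ᵉ y

  ⟦_⟧ᵒ : CObj → Δ → Set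
  ⟦ con C ⟧ᵒ = ⟦ C ⟧ᵉ
  ⟦ ind a ⟧ᵒ x = x ≡ indI a
  ⟦ Πℓ R ⟧ᵒ x = Σ Δ λ y → ⟦ R ⟧ʳ x y
  ⟦ Πr R ⟧ᵒ y = Σ Δ λ x → ⟦ R ⟧ʳ x y

  ≈ʳ-sound : ∀ {R R'} → R ≈ʳ R' → ∀ x y → ⟦ R ⟧ʳ x y ⇔ ⟦ R' ⟧ʳ x y
  ≈ʳ-sound rn-≈ x y = ⇔.refl
  ≈ʳ-sound pr-≈ x y = ⇔.refl
  ≈ʳ-sound 𝔑⊤-≈ x y = ⇔.refl
  ≈ʳ-sound 𝔑⊥-≈ x y = ⇔.refl
  ≈ʳ-sound comp-≈ x y = ⇔.refl
  ≈ʳ-sound (𝔑∃-≈ e) x y = ⇔.refl ×-⇔ ≈-sound e y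

  ≈ᵒ-sound : ∀ {X Y} → X ≈ᶜ Y → ∀ x → ⟦ X ⟧ᵒ x ⇔ ⟦ Y ⟧ᵒ x
  ≈ᵒ-sound (con-≈ e) x = ≈-sound e x
  ≈ᵒ-sound ind-≈ x = ⇔.refl
  ≈ᵒ-sound (Πℓ-≈ e) x = Σ.congˡ (≈ʳ-sound e x _)
  ≈ᵒ-sound (Πr-≈ e) y = Σ.congˡ (≈ʳ-sound e _ y)

module Soundness (O : EOntology) (I : Interpretation) (I⊨O : I ⊨ toSH O) where
  open Interpretation I
  open Semantics I
  open Saturation O

  axiom-holds : ∀ {ax} → ax ∈ O → SatAx I (toSHᵃ ax)
  axiom-holds ax∈O = lookup I⊨O (∈-map⁺ toSHᵃ ax∈O)

  ⇛-sound : ∀ {R S} → R ⇛ S → ∀ {x y} → ⟦ R ⟧ʳ x y → ⟦ S ⟧ʳ x y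
  ⇛-sound (resp R⇛S R≈ S≈) r = to (≈ʳ-sound S≈ _ _) (⇛-sound R⇛S (from (≈ʳ-sound R≈ _ _) r))
  ⇛-sound (it-⊤ _) r = tt
  ⇛-sound (it-⊥ _) ()
  ⇛-sound (it-id _) r = r
  ⇛-sound (tr R⇛S S⇛T) r = ⇛-sound S⇛T (⇛-sound R⇛S r)
  ⇛-sound (ax-rinc ax) r = axiom-holds ax _ _ r
  ⇛-sound (ax-trans ax) (y , r , s) = axiom-holds ax _ y _ r s
  ⇛-sound (ax-ra ax) (refl , refl) = axiom-holds ax
  ⇛-sound (∃-role _) (r , _) = r

  edge-between : ∀ {a b R} → pr a b ⇛ R → ⟦ R ⟧ʳ (indI a) (indI b)
  edge-between ab⇛R = ⇛-sound ab⇛R (refl , refl)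

  ∀-transitive : ∀ {S R} {P : Δ → Set} {x y} → comp S ⇛ rn S → rn S ⇛ rn R
               → (∀ z → roleI R x z → P z) → roleI S x y → ∀ z → roleI S y z → P z
  ∀-transitive S∘S⇛S S⇛R x∈∀RP xSy z ySz = x∈∀RP z (⇛-sound S⇛R (⇛-sound S∘S⇛S (_ , xSy , ySz)))

  ⇒-sound : ∀ {X Y} → X ⇒ Y → ⟦ X ⟧ᵒ ⊆ ⟦ Y ⟧ᵒ
  ⇒-sound (resp X⇒Y X≈ Y≈) p = to (≈ᵒ-sound Y≈ _) (⇒-sound X⇒Y (from (≈ᵒ-sound X≈ _) p))
  ⇒-sound (it-⊤ _) p = tt
  ⇒-sound (it-⊥ _) ()
  ⇒-sound (it-id _) p = p
  ⇒-sound (tr X⇒Y Y⇒Z) p = ⇒-sound Y⇒Z (⇒-sound X⇒Y p)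
  ⇒-sound (f-ℓr ℓ⇒⊥) (x , r) = ⇒-sound ℓ⇒⊥ (_ , r)
  ⇒-sound (f-rℓ r⇒⊥) (y , r) = ⇒-sound r⇒⊥ (_ , r)
  ⇒-sound (ax-gci ax) p = axiom-holds ax _ p
  ⇒-sound (ax-ca ax) refl = axiom-holds ax
  ⇒-sound (⊓d₁ _) (p , q) = p
  ⇒-sound (⊓d₂ _) (p , q) = q
  ⇒-sound (⊓c X⇒C X⇒D _) p = ⇒-sound X⇒C p , ⇒-sound X⇒D p
  ⇒-sound (⊔d₁ C⊔D⇒X) p = ⇒-sound C⊔D⇒X (inj₁ p)
  ⇒-sound (⊔d₂ C⊔D⇒X) p = ⇒-sound C⊔D⇒X (inj₂ p)
  ⇒-sound (⊔c C⇒X D⇒X _) (inj₁ p) = ⇒-sound C⇒X p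
  ⇒-sound (⊔c C⇒X D⇒X _) (inj₂ p) = ⇒-sound D⇒X p
  ⇒-sound (neg X⇒A X⇒¬A) p = ⇒-sound X⇒¬A p (⇒-sound X⇒A p)
  ⇒-sound (∃-ℓ₁ _) p = p
  ⇒-sound (∃-ℓ₂ _) p = p
  ⇒-sound (∃-r _) (x , r , c) = c
  ⇒-sound (∃H _ R'⇛R r⇒C) (y , r) = y , ⇛-sound R'⇛R r , ⇒-sound r⇒C (_ , r)
  ⇒-sound (∃∘ S∘S⇛S X⇒∃SC C⇒∃SD) p with ⇒-sound X⇒∃SC p
  ... | y , xSy , c with ⇒-sound C⇒∃SD c
  ... | z , ySz , d = z , ⇛-sound S∘S⇛S (y , xSy , ySz) , d
  ⇒-sound (∃∀ X⇒∃PC X⇒∀RD P⇛R C⊓D⇒⊥) p with ⇒-sound X⇒∃PC p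
  ... | y , xPy , c = ⇒-sound C⊓D⇒⊥ (c , ⇒-sound X⇒∀RD p y (⇛-sound P⇛R xPy))
  ⇒-sound (∃∀I₁ ab⇛P a⇒∀RD P⇛R) refl =
    _ , edge-between ab⇛P , ⇒-sound a⇒∀RD refl _ (⇛-sound P⇛R (edge-between ab⇛P))
  ⇒-sound (∃∀I₂ ab⇛P a⇒∀RD P⇛R) refl =
    ⇒-sound a⇒∀RD refl _ (⇛-sound P⇛R (edge-between ab⇛P))
  ⇒-sound (∃∘∀ P⇛S S∘S⇛S S⇛R X⇒∃PC X⇒∀RD C⊓∀SD⇒⊥) p with ⇒-sound X⇒∃PC p
  ... | y , xPy , c =
    ⇒-sound C⊓∀SD⇒⊥ (c , ∀-transitive S∘S⇛S S⇛R (⇒-sound X⇒∀RD p) (⇛-sound P⇛S xPy))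
  ⇒-sound (∃∘∀I₁ P⇛S S∘S⇛S S⇛R ab⇛P a⇒∀RD) refl =
    _ , edge-between ab⇛P
      , ∀-transitive S∘S⇛S S⇛R (⇒-sound a⇒∀RD refl) (⇛-sound P⇛S (edge-between ab⇛P))
  ⇒-sound (∃∘∀I₂ P⇛S S∘S⇛S S⇛R ab⇛P a⇒∀RD) refl =
    ∀-transitive S∘S⇛S S⇛R (⇒-sound a⇒∀RD refl) (⇛-sound P⇛S (edge-between ab⇛P))

  consistent : ELConsistent O
  consistent (a , a⇒⊥) = ⇒-sound a⇒⊥ refl

corollary1 : (O : Ontology) → OntologyNNF O → Consistent O → ELConsistent (trO O)
corollary1 O _ (I , I⊨O) =
  Soundness.consistent (trO O) I (subst (I ⊨_) (sym (toSH-trO O)) I⊨O)
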